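{- Let $q\in\mathbb{N}$ with $q\ge 3$. If $p\in\mathbb{N}$, $p\ge 2$, with $\gcd(p,q)=1$, then for all but finitely many $x\in D_p$, the $q$-adic expansion of $x$ contains every digit in $\{0,1,\ldots,q-1\}$.
   Context: For $p\in\mathbb{N}_{\ge2}$, $D_p:=\{\sum_{i=1}^n d_i p^{ -i}: d_i\in\{0,1,\ldots,p-1\}\ \forall 1\le i\le n,\ n\in\mathbb{N}\}$. -}

module Defs where

open import Data.Nat using (ℕ; zero; suc; _+_; _*_; _^_; _≤_; _<_; NonZero; >-nonZero)
open import Data.Nat.Properties using (m^n≢0; ≤-trans; n≤1+n)
open import Data.Nat.DivMod using (_/_; _%_)
open import Data.Fin using (Fin; toℕ)
open import Data.Vec using (Vec; []; _∷_)
open import Data.Product using (Σ; _,_)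
open import Relation.Binary.PropositionalEquality using (_≡_)

-- An element of D_p, given literally as in the paper: a length n and
-- digits d_1 … d_n ∈ {0,…,p-1}; it denotes  Σ_{i=1}^n d_i p^{-i}.
DRep : ℕ → Set
DRep p = Σ ℕ (λ n → Vec (Fin p) n)

numer : ∀ {p n} → Vec (Fin p) n → ℕ
numer {p} {zero} [] = 0
numer {p} {suc n} (d ∷ ds) = toℕ d * p ^ n + numer ds

num : ∀ {p} → DRep p → ℕ
num (n , ds) = numer ds

den : ∀ {p} → DRep p → ℕ
den {p} (n , _) = p ^ n

_≈D_ : ∀ {p} → DRep p → DRep p → Set
x ≈D y = num x * den y ≡ num y * den x

-- k-th digit (k ≥ 1) of the q-adic expansion of x ∈ [0,1):
--   d_k = ⌊ q^k x ⌋ mod q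
qDigit : (p q : ℕ) → 2 ≤ p → 3 ≤ q → DRep p → ℕ → ℕ
qDigit p q hp hq (n , ds) k =
  _%_ (_/_ (q ^ k * numer ds) (p ^ n) {{m^n≢0 p n {{nzp}}}}) q {{nzq}}
  where
  nzp : NonZero p
  nzp = >-nonZero (≤-trans (n≤1+n 1) hp)
  nzq : NonZero q
  nzq = >-nonZero (≤-trans (≤-trans (n≤1+n 1) (n≤1+n 2)) hq)

{-# OPTIONS --safe #-}
-- Write x = N / p ^ n. Since p ∤ q, some q ^ e = 1 + h₀ with p² ∣ h₀, and lifting the exponent gives
-- q ^ (e p ^ m) = 1 + h with h = h₀ p ^ m u, u ≡ 1 (mod p). Once p ^ n ∣ N h², the binomial theorem
-- gives (1 + h) ^ S N ≡ N + S N h (mod p ^ n), so by Bézout the fractional parts of q ^ (e p ^ m S) x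
-- run through a whole class modulo d / p ^ n, d = gcd (N h) (p ^ n). Unless the reduced denominator of x
-- is small (finitely many x), m can be chosen with q d ≤ p ^ n; then some fractional part lies in
-- [c / q , (c + 1) / q), i.e. the next q-adic digit is c.
module Submission where

open import Defs
open import Data.Nat using (ℕ; _≤_; _<_)
open import Data.Nat.GCD using (gcd)
open import Data.List using (List)
open import Data.List.Relation.Unary.Any using (Any)
open import Data.Product using (Σ; _×_)
open import Relation.Nullary using (¬_)
open import Relation.Binary.PropositionalEquality using (_≡_)

open import Data.Nat
open import Data.Nat.Properties
open import Data.Nat.Divisibility
open import Data.Nat.DivMod
open import Data.Nat.GCD
  using (module Bézout; gcd-GCD; gcd[m,n]∣m; gcd[m,n]∣n; gcd[m,n]≡0⇒n≡0; gcd-greatest; c*gcd[m,n]≡gcd[cm,cn])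
open import Data.Nat.Coprimality using (Coprime; coprime-divisor; gcd≡1⇒coprime)
import Data.Nat.Coprimality as Coprime
open import Data.Nat.Tactic.RingSolver using (solve-∀)
open import Data.Fin using (Fin; toℕ; fromℕ<)
open import Data.Fin.Properties using (pigeonhole; toℕ-fromℕ<; toℕ<n)
open import Data.Vec using (Vec; []; _∷_)
open import Data.List using (map; upTo)
open import Data.List.Relation.Unary.Any.Properties using (map⁺)
open import Data.List.Membership.Propositional using (lose)
open import Data.List.Membership.Propositional.Properties using (∈-upTo⁺)
open import Data.Product using (_,_; proj₁; proj₂; ∃-syntax)
open import Relation.Nullary using (Dec; yes; no; contradiction)
open import Relation.Binary.PropositionalEquality
  using (refl; sym; trans; cong; cong₂; subst; subst₂; module ≡-Reasoning)

binomial-[1+h]^s : ∀ h s → ∃[ C ] (1 + h) ^ s ≡ 1 + s * h + h * h * C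
binomial-[1+h]^s h zero = 0 , cong suc (sym (*-zeroʳ (h * h)))
binomial-[1+h]^s h (suc s) with binomial-[1+h]^s h s
... | C , [1+h]^s≡ = s + C + h * C , (begin
  (1 + h) * (1 + h) ^ s                    ≡⟨ cong ((1 + h) *_) [1+h]^s≡ ⟩
  (1 + h) * (1 + s * h + h * h * C)        ≡⟨ expand h s C ⟩
  1 + suc s * h + h * h * (s + C + h * C)  ∎)
  where
  open ≡-Reasoning
  expand : ∀ h s C → (1 + h) * (1 + s * h + h * h * C) ≡ 1 + suc s * h + h * h * (s + C + h * C)
  expand = solve-∀

^-monoʳ-∣ : ∀ p {k l} → k ≤ l → p ^ k ∣ p ^ l
^-monoʳ-∣ p {k} {l} k≤l = divides (p ^ (l ∸ k)) (begin
  p ^ l                ≡⟨ cong (p ^_) (sym (m+[n∸m]≡n k≤l)) ⟩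
  p ^ (k + (l ∸ k))    ≡⟨ ^-distribˡ-+-* p k (l ∸ k) ⟩
  p ^ k * p ^ (l ∸ k)  ≡⟨ *-comm (p ^ k) _ ⟩
  p ^ (l ∸ k) * p ^ k  ∎)
  where open ≡-Reasoning

coprime-∣ʳ : ∀ {a b d} → Coprime a b → d ∣ b → Coprime a d
coprime-∣ʳ a⊥b d∣b (e∣a , e∣d) = a⊥b (e∣a , ∣-trans e∣d d∣b)

coprime-^ʳ : ∀ {a p} n → Coprime a p → Coprime a (p ^ n)
coprime-^ʳ zero a⊥p (_ , e∣1) = ∣1⇒≡1 e∣1
coprime-^ʳ {a} {p} (suc n) a⊥p {e} (e∣a , e∣p*p^n) = coprime-^ʳ n a⊥p (e∣a , coprime-divisor e⊥p e∣p*p^n)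
  where
  e⊥p : Coprime e p
  e⊥p (f∣e , f∣p) = a⊥p (∣-trans f∣e e∣a , f∣p)

1+p*w-coprime : ∀ p w → Coprime (1 + p * w) p
1+p*w-coprime p w {e} (e∣1+p*w , e∣p) =
  ∣1⇒≡1 (∣m+n∣m⇒∣n (subst (e ∣_) (+-comm 1 (p * w)) e∣1+p*w) (∣m⇒∣m*n w e∣p))

coprime-cancel : ∀ {p u d m} n → Coprime u p → d ∣ p ^ n → d ∣ m * u → d ∣ m
coprime-cancel {u = u} {d} {m} n u⊥p d∣p^n d∣m*u =
  coprime-divisor (Coprime.sym (coprime-∣ʳ (coprime-^ʳ n u⊥p) d∣p^n)) (subst (d ∣_) (*-comm m u) d∣m*u)

-- Divisors of powers

∣p^n⇒∣p^j : ∀ {p d n} j .{{_ : NonZero p}} → d ∣ p ^ n → d ≤ j → d ∣ p ^ j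
∣p^n⇒∣p^j {p} {d} {n} zero d∣p^n z≤n = contradiction (0∣⇒≡0 d∣p^n) (≢-nonZero⁻¹ (p ^ n) {{m^n≢0 p n}})
∣p^n⇒∣p^j {p} {d} {n} (suc j) d∣p^n d≤1+j with gcd d p ≟ 1
... | yes gcd≡1 = subst (_∣ p ^ suc j) (sym d≡1) (1∣ _)
  where
  d≡1 : d ≡ 1
  d≡1 = coprime-^ʳ n (gcd≡1⇒coprime gcd≡1) (∣-refl , d∣p^n)
... | no gcd≢1 with gcd[m,n]∣m d p
... | divides d' d≡d'*g = subst (_∣ p ^ suc j) (sym d≡d'*g) (subst (d' * g ∣_) (*-comm (p ^ j) p) d'*g∣p^j*p)
  where
  g = gcd d p
  instance
    g≢0 : NonZero g
    g≢0 = ≢-nonZero (λ g≡0 → ≢-nonZero⁻¹ p (gcd[m,n]≡0⇒n≡0 d g≡0))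
    d≢0 : NonZero d
    d≢0 = ≢-nonZero (λ d≡0 → ≢-nonZero⁻¹ (p ^ n) {{m^n≢0 p n}} (0∣⇒≡0 (subst (_∣ p ^ n) d≡0 d∣p^n)))
    d'≢0 : NonZero d'
    d'≢0 = m*n≢0⇒m≢0 d' {g} {{subst NonZero d≡d'*g d≢0}}
  1<g : 1 < g
  1<g = ≤∧≢⇒< (>-nonZero⁻¹ g) (λ 1≡g → gcd≢1 (sym 1≡g))
  d'<d : d' < d
  d'<d = subst (d' <_) (sym d≡d'*g) (m<m*n d' g 1<g)
  d'∣p^j : d' ∣ p ^ j
  d'∣p^j = ∣p^n⇒∣p^j {n = n} j (∣-trans (divides g (trans d≡d'*g (*-comm d' g))) d∣p^n) (≤-pred (≤-trans d'<d d≤1+j))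
  d'*g∣p^j*p : d' * g ∣ p ^ j * p
  d'*g∣p^j*p = *-pres-∣ d'∣p^j (gcd[m,n]∣n d p)

∣p^n⇒∣*p^k : ∀ {p d n m} k .{{_ : NonZero p}} .{{_ : NonZero k}} → d ∣ p ^ n → d ∣ m * k → d ∣ m * p ^ k
∣p^n⇒∣*p^k {p} {d} {n} {m} k d∣p^n d∣m*k = ∣-trans d∣m*gcd (*-monoʳ-∣ m gcd∣p^k)
  where
  d∣m*gcd : d ∣ m * gcd k d
  d∣m*gcd = subst (d ∣_) (sym (c*gcd[m,n]≡gcd[cm,cn] m k d)) (gcd-greatest d∣m*k (n∣m*n m))
  gcd∣p^k : gcd k d ∣ p ^ k
  gcd∣p^k = ∣p^n⇒∣p^j {n = n} k (∣-trans (gcd[m,n]∣n k d) d∣p^n) (∣⇒≤ (gcd[m,n]∣m k d))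

-- Lifting the exponent

lift-step : ∀ p {h} → p * p ∣ h → ∃[ w ] (1 + h) ^ p ≡ 1 + h * p * (1 + p * w)
lift-step p {h} (divides v h≡v*p*p) with binomial-[1+h]^s h p
... | C , [1+h]^p≡ = v * C , (begin
  (1 + h) ^ p                        ≡⟨ [1+h]^p≡ ⟩
  1 + p * h + h * h * C              ≡⟨ cong (λ t → 1 + p * h + h * t * C) h≡v*p*p ⟩
  1 + p * h + h * (v * (p * p)) * C  ≡⟨ regroup p h v C ⟩
  1 + h * p * (1 + p * (v * C))      ∎)
  where
  open ≡-Reasoning
  regroup : ∀ p h v C → 1 + p * h + h * (v * (p * p)) * C ≡ 1 + h * p * (1 + p * (v * C))
  regroup = solve-∀

lift-exponent : ∀ p {h} → p * p ∣ h → ∀ i → ∃[ w ] (1 + h) ^ (p ^ i) ≡ 1 + h * p ^ i * (1 + p * w)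
lift-exponent p {h} p²∣h zero = 0 , base h p
  where
  base : ∀ h p → (1 + h) * 1 ≡ 1 + h * 1 * (1 + p * 0)
  base = solve-∀
lift-exponent p {h} p²∣h (suc i) with lift-exponent p p²∣h i
... | w , [1+h]^p^i≡ with lift-step p {h * p ^ i * (1 + p * w)} (∣m⇒∣m*n _ (∣m⇒∣m*n _ p²∣h))
... | w' , [1+hᵢ]^p≡ = w + w' + p * w * w' , (begin
  (1 + h) ^ (p * p ^ i)                           ≡⟨ cong ((1 + h) ^_) (*-comm p (p ^ i)) ⟩
  (1 + h) ^ (p ^ i * p)                           ≡⟨ sym (^-*-assoc (1 + h) (p ^ i) p) ⟩
  ((1 + h) ^ (p ^ i)) ^ p                         ≡⟨ cong (_^ p) [1+h]^p^i≡ ⟩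
  (1 + h * p ^ i * (1 + p * w)) ^ p               ≡⟨ [1+hᵢ]^p≡ ⟩
  1 + h * p ^ i * (1 + p * w) * p * (1 + p * w')  ≡⟨ regroup h p (p ^ i) w w' ⟩
  1 + h * (p * p ^ i) * (1 + p * (w + w' + p * w * w'))  ∎)
  where
  open ≡-Reasoning
  regroup : ∀ h p P w w' →
    1 + h * P * (1 + p * w) * p * (1 + p * w') ≡ 1 + h * (p * P) * (1 + p * (w + w' + p * w * w'))
  regroup = solve-∀

%≡%⇒∣∸ : ∀ m .{{_ : NonZero m}} {x y} → x % m ≡ y % m → x ≤ y → m ∣ y ∸ x
%≡%⇒∣∸ m {x} {y} x%m≡y%m x≤y = divides (y / m ∸ x / m) (begin
  y ∸ x                                      ≡⟨ cong₂ _∸_ (m≡m%n+[m/n]*n y m) (m≡m%n+[m/n]*n x m) ⟩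
  (y % m + y / m * m) ∸ (x % m + x / m * m)  ≡⟨ cong (λ r → (y % m + y / m * m) ∸ (r + x / m * m)) x%m≡y%m ⟩
  (y % m + y / m * m) ∸ (y % m + x / m * m)  ≡⟨ [m+n]∸[m+o]≡n∸o (y % m) _ _ ⟩
  y / m * m ∸ x / m * m                      ≡⟨ sym (*-distribʳ-∸ m (y / m) (x / m)) ⟩
  (y / m ∸ x / m) * m                        ∎)
  where open ≡-Reasoning

power≡1+multiple : ∀ m q .{{_ : NonZero m}} → 2 ≤ q → Coprime m q →
  ∃[ e ] ∃[ h ] 1 ≤ h × q ^ e ≡ 1 + h × m ∣ h
power≡1+multiple m q 2≤q m⊥q with pigeonhole (n<1+n m) (λ k → fromℕ< (m%n<n (q ^ toℕ k) m))
... | i₀ , j₀ , i<j , same-residue = e , h , 1≤h , q^e≡1+h , m∣h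
  where
  instance
    q≢0 : NonZero q
    q≢0 = >-nonZero (≤-trans (s≤s z≤n) 2≤q)
  i = toℕ i₀
  e = toℕ j₀ ∸ i
  h = q ^ e ∸ 1
  2≤q^e : 2 ≤ q ^ e
  2≤q^e = ≤-trans 2≤q (subst (_≤ q ^ e) (*-identityʳ q) (^-monoʳ-≤ q {1} {e} (m<n⇒0<n∸m i<j)))
  1≤h : 1 ≤ h
  1≤h = ∸-monoˡ-≤ 1 2≤q^e
  q^e≡1+h : q ^ e ≡ 1 + h
  q^e≡1+h = sym (m+[n∸m]≡n (≤-trans (s≤s z≤n) 2≤q^e))
  q^j≡q^i*q^e : q ^ toℕ j₀ ≡ q ^ i * q ^ e
  q^j≡q^i*q^e = trans (cong (q ^_) (sym (m+[n∸m]≡n (<⇒≤ i<j)))) (^-distribˡ-+-* q i e)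
  same-residue′ : q ^ i % m ≡ q ^ toℕ j₀ % m
  same-residue′ = trans (sym (toℕ-fromℕ< (m%n<n (q ^ i) m)))
                    (trans (cong toℕ same-residue) (toℕ-fromℕ< (m%n<n (q ^ toℕ j₀) m)))
  m∣q^i*h : m ∣ q ^ i * h
  m∣q^i*h = subst (m ∣_) (begin
    q ^ toℕ j₀ ∸ q ^ i            ≡⟨ cong₂ _∸_ q^j≡q^i*q^e (sym (*-identityʳ (q ^ i))) ⟩
    q ^ i * q ^ e ∸ q ^ i * 1     ≡⟨ sym (*-distribˡ-∸ (q ^ i) (q ^ e) 1) ⟩
    q ^ i * h                     ∎)
    (%≡%⇒∣∸ m same-residue′ (subst (q ^ i ≤_) (sym q^j≡q^i*q^e) (m≤m*n (q ^ i) (q ^ e) {{m^n≢0 q e}})))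
    where open ≡-Reasoning
  m∣h : m ∣ h
  m∣h = coprime-divisor (coprime-^ʳ i m⊥q) m∣q^i*h

threshold : ∀ {Q : ℕ → Set} → (∀ k → Dec (Q k)) → ∀ {a} b → ¬ Q a → Q (b + a) →
  ∃[ i ] a ≤ i × ¬ Q i × Q (suc i)
threshold Q? zero ¬Qa Qa = contradiction Qa ¬Qa
threshold {Q} Q? {a} (suc b) ¬Qa Q[1+b+a] with Q? (suc a)
... | yes Q[1+a] = a , ≤-refl , ¬Qa , Q[1+a]
... | no ¬Q[1+a] with threshold Q? b ¬Q[1+a] (subst Q (sym (+-suc b a)) Q[1+b+a])
...   | i , 1+a≤i , ¬Qi , Q[1+i] = i , ≤-trans (n≤1+n a) 1+a≤i , ¬Qi , Q[1+i]

-- q-adic digits and orbits modulo P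

digit-%ʳ : ∀ q P X .{{_ : NonZero q}} .{{_ : NonZero P}} → (q * X) / P % q ≡ (q * (X % P)) / P
digit-%ʳ q P X = begin
  (q * X) / P % q                              ≡⟨ cong (λ t → (q * t) / P % q) (m≡m%n+[m/n]*n X P) ⟩
  (q * (X % P + X / P * P)) / P % q            ≡⟨ cong (λ t → t / P % q) (distribute q (X % P) (X / P) P) ⟩
  (q * (X % P) + X / P * q * P) / P % q        ≡⟨ cong (_% q) (+-distrib-/-∣ʳ (q * (X % P)) (n∣m*n (X / P * q))) ⟩
  ((q * (X % P)) / P + X / P * q * P / P) % q  ≡⟨ cong (λ t → ((q * (X % P)) / P + t) % q) (m*n/n≡m (X / P * q) P) ⟩
  ((q * (X % P)) / P + X / P * q) % q          ≡⟨ [m+kn]%n≡m%n _ (X / P) q ⟩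
  (q * (X % P)) / P % q                        ≡⟨ m<n⇒m%n≡m (m<n*o⇒m/o<n (*-monoʳ-< q (m%n<n X P))) ⟩
  (q * (X % P)) / P                            ∎
  where
  open ≡-Reasoning
  distribute : ∀ q r k P → q * (r + k * P) ≡ q * r + k * q * P
  distribute = solve-∀

/-inside-window : ∀ {c P x} .{{_ : NonZero P}} → c * P ≤ x → x < suc c * P → x / P ≡ c
/-inside-window {c} {P} cP≤x x<[1+c]P =
  ≤-antisym (≤-pred (m<n*o⇒m/o<n x<[1+c]P)) (subst (_≤ _) (m*n/n≡m c P) (/-monoˡ-≤ P cP≤x))

hits-window : ∀ (f : ℕ → ℕ) {T W} → f 0 < T + W → (∀ k → f (suc k) ≤ f k + W) →
  ∀ B → T ≤ f B → ∃[ k ] T ≤ f k × f k < T + W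
hits-window f f0<T+W step zero T≤f0 = 0 , T≤f0 , f0<T+W
hits-window f {T} {W} f0<T+W step (suc B) T≤f[1+B] with T ≤? f B
... | yes T≤fB = hits-window f f0<T+W step B T≤fB
... | no T≰fB = suc B , T≤f[1+B] , ≤-<-trans (step B) (+-monoˡ-< W (≰⇒> T≰fB))

%-cong-+* : ∀ {P x y} .{{_ : NonZero P}} u t → x % P ≡ y % P → (u + t * x) % P ≡ (u + t * y) % P
%-cong-+* {P} {x} {y} u t x%P≡y%P = begin
  (u + t * x) % P                      ≡⟨ %-distribˡ-+ u (t * x) P ⟩
  (u % P + t * x % P) % P              ≡⟨ cong (λ r → (u % P + r) % P) (%-distribˡ-* t x P) ⟩
  (u % P + t % P * (x % P) % P) % P    ≡⟨ cong (λ r → (u % P + t % P * r % P) % P) x%P≡y%P ⟩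
  (u % P + t % P * (y % P) % P) % P    ≡⟨ cong (λ r → (u % P + r) % P) (sym (%-distribˡ-* t y P)) ⟩
  (u % P + t * y % P) % P              ≡⟨ sym (%-distribˡ-+ u (t * y) P) ⟩
  (u + t * y) % P                      ∎
  where open ≡-Reasoning

bézout-% : ∀ {d A P} .{{_ : NonZero P}} → Bézout.Identity d A P → d ∣ P → ∃[ s ] s * A % P ≡ d % P
bézout-% {d} {A} {P} (Bézout.+- x y d+yP≡xA) _ = x , (begin
  x * A % P          ≡⟨ cong (_% P) (sym d+yP≡xA) ⟩
  (d + y * P) % P    ≡⟨ [m+kn]%n≡m%n d y P ⟩
  d % P              ∎)
  where open ≡-Reasoning
bézout-% {P = P} (Bézout.-+ x y d+xA≡yP) (divides zero P≡0) = contradiction P≡0 (≢-nonZero⁻¹ P)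
bézout-% {d} {A} {P} (Bézout.-+ x y d+xA≡yP) (divides (suc r) P≡[1+r]d) = r * x , (begin
  r * x * A % P                ≡⟨ sym ([m+n]%n≡m%n (r * x * A) P) ⟩
  (r * x * A + P) % P          ≡⟨ cong (λ t → (r * x * A + t) % P) P≡[1+r]d ⟩
  (r * x * A + suc r * d) % P  ≡⟨ cong (_% P) (regroup r x A d) ⟩
  (d + r * (d + x * A)) % P    ≡⟨ cong (λ t → (d + r * t) % P) d+xA≡yP ⟩
  (d + r * (y * P)) % P        ≡⟨ cong (λ t → (d + t) % P) (sym (*-assoc r y P)) ⟩
  (d + r * y * P) % P          ≡⟨ [m+kn]%n≡m%n d (r * y) P ⟩
  d % P                        ∎)
  where
  open ≡-Reasoning
  regroup : ∀ r x A d → r * x * A + suc r * d ≡ d + r * (d + x * A)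
  regroup = solve-∀

[1+h]^s*N≡N+s*N*h : ∀ {P N h} .{{_ : NonZero P}} → P ∣ N * (h * h) →
  ∀ s → (1 + h) ^ s * N % P ≡ (N + s * (N * h)) % P
[1+h]^s*N≡N+s*N*h {P} {N} {h} P∣Nh² s with binomial-[1+h]^s h s
... | C , [1+h]^s≡ = begin
  (1 + h) ^ s * N % P                      ≡⟨ cong (λ t → t * N % P) [1+h]^s≡ ⟩
  (1 + s * h + h * h * C) * N % P          ≡⟨ cong (_% P) (expand s h C N) ⟩
  (N + s * (N * h) + N * (h * h) * C) % P  ≡⟨ %-remove-+ʳ _ (∣m⇒∣m*n C P∣Nh²) ⟩
  (N + s * (N * h)) % P                    ∎
  where
  open ≡-Reasoning
  expand : ∀ s h C N → (1 + s * h + h * h * C) * N ≡ N + s * (N * h) + N * (h * h) * C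
  expand = solve-∀

orbit-reaches-N+t*d : ∀ {P N h} .{{_ : NonZero P}} → P ∣ N * (h * h) →
  ∀ t → ∃[ S ] (1 + h) ^ S * N % P ≡ (N + t * gcd (N * h) P) % P
orbit-reaches-N+t*d {P} {N} {h} P∣Nh² t with bézout-% (Bézout.identity (gcd-GCD (N * h) P)) (gcd[m,n]∣n (N * h) P)
... | s , sNh≡d = t * s , (begin
  (1 + h) ^ (t * s) * N % P      ≡⟨ [1+h]^s*N≡N+s*N*h P∣Nh² (t * s) ⟩
  (N + t * s * (N * h)) % P      ≡⟨ cong (λ u → (N + u) % P) (*-assoc t s (N * h)) ⟩
  (N + t * (s * (N * h))) % P    ≡⟨ %-cong-+* N t sNh≡d ⟩
  (N + t * gcd (N * h) P) % P    ∎)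
  where open ≡-Reasoning

class-meets-window : ∀ {q P d} .{{_ : NonZero q}} .{{_ : NonZero d}} → q * d ≤ P → ∀ N c →
  ∃[ b ] c * P ≤ q * (N % d + b * d) × q * (N % d + b * d) < suc c * P
class-meets-window {q} {P} {d} qd≤P N c with hits-window (λ b → q * (N % d + b * d)) f0<cP+P step (c * P) cP≤f[cP]
  where
  f0<cP+P : q * (N % d + 0) < c * P + P
  f0<cP+P = <-≤-trans (*-monoʳ-< q (subst (_< d) (sym (+-identityʳ (N % d))) (m%n<n N d)))
                      (≤-trans qd≤P (m≤n+m P (c * P)))
  step : ∀ b → q * (N % d + suc b * d) ≤ q * (N % d + b * d) + P
  step b = subst (_≤ q * (N % d + b * d) + P) (sym (split q (N % d) b d)) (+-monoʳ-≤ (q * (N % d + b * d)) qd≤P)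
    where
    split : ∀ q r b d → q * (r + suc b * d) ≡ q * (r + b * d) + q * d
    split = solve-∀
  cP≤f[cP] : c * P ≤ q * (N % d + c * P * d)
  cP≤f[cP] = ≤-trans (m≤m*n (c * P) d) (≤-trans (m≤n+m (c * P * d) (N % d)) (m≤n*m _ q))
... | b , cP≤qz , qz<cP+P = b , cP≤qz , subst (q * (N % d + b * d) <_) (+-comm (c * P) P) qz<cP+P

-- The residues of (1 + h) ^ S N modulo P fill the class of N modulo gcd (N h) P ≤ P / q,
-- so one of them lands in every window [c P / q , (c + 1) P / q).
every-digit-in-orbit : ∀ {q P N h} .{{_ : NonZero q}} .{{_ : NonZero P}} →
  P ∣ N * (h * h) → q * gcd (N * h) P ≤ P →
  ∀ {c} → c < q → ∃[ S ] (q * ((1 + h) ^ S * N)) / P % q ≡ c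
every-digit-in-orbit {q} {P} {N} {h} P∣Nh² qd≤P {c} c<q with gcd[m,n]∣n (N * h) P
... | divides zero P≡0 = contradiction P≡0 (≢-nonZero⁻¹ P)
... | divides (suc R) P≡[1+R]d = S , (begin
  (q * X) / P % q    ≡⟨ digit-%ʳ q P X ⟩
  (q * (X % P)) / P  ≡⟨ cong (λ t → (q * t) / P) X%P≡z ⟩
  (q * z) / P        ≡⟨ /-inside-window cP≤qz qz<[1+c]P ⟩
  c                  ∎)
  where
  open ≡-Reasoning
  d = gcd (N * h) P
  instance
    d≢0 : NonZero d
    d≢0 = ≢-nonZero (λ d≡0 → ≢-nonZero⁻¹ P (trans P≡[1+R]d (trans (cong (suc R *_) d≡0) (*-zeroʳ (suc R)))))
  b = proj₁ (class-meets-window qd≤P N c)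
  z = N % d + b * d
  cP≤qz : c * P ≤ q * z
  cP≤qz = proj₁ (proj₂ (class-meets-window qd≤P N c))
  qz<[1+c]P : q * z < suc c * P
  qz<[1+c]P = proj₂ (proj₂ (class-meets-window qd≤P N c))
  z<P : z < P
  z<P = *-cancelˡ-< q z P (<-≤-trans qz<[1+c]P (*-monoˡ-≤ P c<q))
  t = b + R * (N / d)
  N+td≡z+[N/d]P : N + t * d ≡ z + N / d * P
  N+td≡z+[N/d]P = begin
    N + t * d                            ≡⟨ cong (_+ t * d) (m≡m%n+[m/n]*n N d) ⟩
    N % d + N / d * d + t * d            ≡⟨ regroup (N % d) (N / d) b R d ⟩
    N % d + b * d + N / d * (suc R * d)  ≡⟨ cong (λ u → z + N / d * u) (sym P≡[1+R]d) ⟩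
    z + N / d * P                        ∎
    where
    regroup : ∀ r a b R d → r + a * d + (b + R * a) * d ≡ r + b * d + a * (suc R * d)
    regroup = solve-∀
  S = proj₁ (orbit-reaches-N+t*d {N = N} {h} P∣Nh² t)
  X = (1 + h) ^ S * N
  X%P≡z : X % P ≡ z
  X%P≡z = begin
    X % P                ≡⟨ proj₂ (orbit-reaches-N+t*d {N = N} {h} P∣Nh² t) ⟩
    (N + t * d) % P      ≡⟨ cong (_% P) N+td≡z+[N/d]P ⟩
    (z + N / d * P) % P  ≡⟨ [m+kn]%n≡m%n z (N / d) P ⟩
    z % P                ≡⟨ m<n⇒m%n≡m z<P ⟩
    z                    ∎

-- If R = p ^ n / d were < q, it would divide p ^ q; as d ∣ M p ^ k, then p ^ n = R d ∣ M p ^ (q + k).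
q*gcd≤p^n : ∀ {p q n k u M} .{{_ : NonZero p}} .{{_ : NonZero k}} → Coprime u p →
  ¬ (p ^ n ∣ M * p ^ (q + k)) → q * gcd (M * (k * u)) (p ^ n) ≤ p ^ n
q*gcd≤p^n {p} {q} {n} {k} {u} {M} u⊥p p^n∤Mp^[q+k] =
  subst (q * d ≤_) (sym P≡R*d) (*-monoˡ-≤ d (≮⇒≥ (λ R<q → p^n∤Mp^[q+k] (P∣ R<q))))
  where
  d = gcd (M * (k * u)) (p ^ n)
  d∣P : d ∣ p ^ n
  d∣P = gcd[m,n]∣n (M * (k * u)) (p ^ n)
  R = quotient d∣P
  P≡R*d : p ^ n ≡ R * d
  P≡R*d = m∣n⇒n≡quotient*m d∣P
  d∣Mp^k : d ∣ M * p ^ k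
  d∣Mp^k = ∣p^n⇒∣*p^k {p} {n = n} {m = M} k d∣P
    (coprime-cancel n u⊥p d∣P (subst (d ∣_) (sym (*-assoc M k u)) (gcd[m,n]∣m (M * (k * u)) (p ^ n))))
  P∣ : R < q → p ^ n ∣ M * p ^ (q + k)
  P∣ R<q = subst₂ _∣_ (sym P≡R*d) regroup (*-pres-∣ R∣p^q d∣Mp^k)
    where
    R∣p^q : R ∣ p ^ q
    R∣p^q = ∣p^n⇒∣p^j {n = n} q (quotient-∣ d∣P) (<⇒≤ R<q)
    regroup : p ^ q * (M * p ^ k) ≡ M * p ^ (q + k)
    regroup = trans (swap (p ^ q) M (p ^ k)) (cong (M *_) (sym (^-distribˡ-+-* p q k)))
      where
      swap : ∀ a M b → a * (M * b) ≡ M * (a * b)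
      swap = solve-∀

module _ {p q e h₀ : ℕ} .{{_ : NonZero p}} .{{_ : NonZero q}} .{{_ : NonZero h₀}}
         (q^e≡1+h₀ : q ^ e ≡ 1 + h₀) (p²∣h₀ : p * p ∣ h₀) where

  -- Choose m with p ^ n ∤ N p ^ (2 m - 2) but p ^ n ∣ N p ^ (2 m), and 1 + h = q ^ (e p ^ m):
  -- p ^ m ∣ h gives p ^ n ∣ N h², and p ^ n ∤ N p ^ (m + q + h₀) gives q gcd (N h) (p ^ n) ≤ p ^ n.
  every-digit-occurs : ∀ n N a → q + h₀ < a → ¬ (p ^ n ∣ N * p ^ (a + a)) →
    ∀ {c} → c < q → ∃[ K ] _/_ (q ^ suc K * N) (p ^ n) {{m^n≢0 p n}} % q ≡ c
  every-digit-occurs n N a q+h₀<a p^n∤ {c} c<q = K , (begin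
    q ^ suc K * N / P % q              ≡⟨ cong (λ X → X / P % q) (*-assoc q (q ^ K) N) ⟩
    q * (q ^ K * N) / P % q            ≡⟨ cong (λ Y → q * (Y * N) / P % q) q^K≡[1+h]^S ⟩
    q * ((1 + h) ^ S * N) / P % q      ≡⟨ proj₂ orbit ⟩
    c                                  ∎)
    where
    open ≡-Reasoning
    instance
      P≢0 : NonZero (p ^ n)
      P≢0 = m^n≢0 p n
    P = p ^ n
    Q : ℕ → Set
    Q i = P ∣ N * p ^ (i + i)
    Q[n+a] : Q (n + a)
    Q[n+a] = ∣n⇒∣m*n N (^-monoʳ-∣ p (≤-trans (m≤m+n n a) (m≤m+n (n + a) (n + a))))
    found = threshold {Q} (λ i → P ∣? N * p ^ (i + i)) n p^n∤ Q[n+a]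
    i = proj₁ found
    a≤i = proj₁ (proj₂ found)
    ¬Qi = proj₁ (proj₂ (proj₂ found))
    Q[1+i] = proj₂ (proj₂ (proj₂ found))
    m = suc i
    w = proj₁ (lift-exponent p p²∣h₀ m)
    h = h₀ * p ^ m * (1 + p * w)
    p^m∣h : p ^ m ∣ h
    p^m∣h = ∣m⇒∣m*n (1 + p * w) (n∣m*n h₀)
    P∣Nh² : P ∣ N * (h * h)
    P∣Nh² = ∣-trans Q[1+i] (*-monoʳ-∣ N (subst (_∣ h * h) (sym (^-distribˡ-+-* p m m)) (*-pres-∣ p^m∣h p^m∣h)))
    m+q+h₀≤i+i : m + (q + h₀) ≤ i + i
    m+q+h₀≤i+i = subst (_≤ i + i) (+-suc i (q + h₀)) (+-monoʳ-≤ i (≤-trans q+h₀<a a≤i))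
    P∤Np^m*p^[q+h₀] : ¬ (P ∣ N * p ^ m * p ^ (q + h₀))
    P∤Np^m*p^[q+h₀] P∣ = ¬Qi (∣-trans P∣ (subst (_∣ N * p ^ (i + i))
      (trans (cong (N *_) (^-distribˡ-+-* p m (q + h₀))) (sym (*-assoc N (p ^ m) (p ^ (q + h₀)))))
      (*-monoʳ-∣ N (^-monoʳ-∣ p m+q+h₀≤i+i))))
    qd≤P : q * gcd (N * h) P ≤ P
    qd≤P = subst (λ A → q * gcd A P ≤ P) (regroup N (p ^ m) h₀ (1 + p * w))
             (q*gcd≤p^n {q = q} {n} {h₀} {M = N * p ^ m} (1+p*w-coprime p w) P∤Np^m*p^[q+h₀])
      where
      regroup : ∀ N P h₀ u → N * P * (h₀ * u) ≡ N * (h₀ * P * u)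
      regroup = solve-∀
    orbit = every-digit-in-orbit {N = N} {h} P∣Nh² qd≤P c<q
    S = proj₁ orbit
    K = e * (p ^ m * S)
    q^K≡[1+h]^S : q ^ K ≡ (1 + h) ^ S
    q^K≡[1+h]^S = begin
      q ^ (e * (p ^ m * S))    ≡⟨ sym (^-*-assoc q e (p ^ m * S)) ⟩
      (q ^ e) ^ (p ^ m * S)    ≡⟨ sym (^-*-assoc (q ^ e) (p ^ m) S) ⟩
      ((q ^ e) ^ p ^ m) ^ S    ≡⟨ cong (λ Y → (Y ^ p ^ m) ^ S) q^e≡1+h₀ ⟩
      ((1 + h₀) ^ p ^ m) ^ S   ≡⟨ cong (_^ S) (proj₂ (lift-exponent p p²∣h₀ m)) ⟩
      (1 + h) ^ S              ∎

-- Finitely many exceptions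

numer<p^n : ∀ {p n} (ds : Vec (Fin p) n) → numer ds < p ^ n
numer<p^n {p} {zero} [] = s≤s z≤n
numer<p^n {p} {suc n} (d ∷ ds) = begin-strict
  toℕ d * p ^ n + numer ds  <⟨ +-monoʳ-< (toℕ d * p ^ n) (numer<p^n ds) ⟩
  toℕ d * p ^ n + p ^ n     ≡⟨ +-comm (toℕ d * p ^ n) (p ^ n) ⟩
  suc (toℕ d) * p ^ n       ≤⟨ *-monoˡ-≤ (p ^ n) (toℕ<n d) ⟩
  p * p ^ n                 ∎
  where open ≤-Reasoning

toDigits : ∀ p .{{_ : NonZero p}} n → ℕ → Vec (Fin p) n
toDigits p zero M = []
toDigits p (suc n) M = fromℕ< (m%n<n (M / p ^ n) p) ∷ toDigits p n (M % p ^ n)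
  where instance _ = m^n≢0 p n

numer-toDigits : ∀ p .{{_ : NonZero p}} n {M} → M < p ^ n → numer (toDigits p n M) ≡ M
numer-toDigits p zero {zero} _ = refl
numer-toDigits p zero {suc M} (s≤s ())
numer-toDigits p (suc n) {M} M<p*p^n = begin
  toℕ (fromℕ< (m%n<n (M / p ^ n) p)) * p ^ n + numer (toDigits p n (M % p ^ n))
    ≡⟨ cong₂ (λ a b → a * p ^ n + b) (toℕ-fromℕ< (m%n<n (M / p ^ n) p)) (numer-toDigits p n (m%n<n M (p ^ n))) ⟩
  M / p ^ n % p * p ^ n + M % p ^ n
    ≡⟨ cong (λ a → a * p ^ n + M % p ^ n) (m<n⇒m%n≡m (m<n*o⇒m/o<n {M} {p} {p ^ n} M<p*p^n)) ⟩
  M / p ^ n * p ^ n + M % p ^ n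
    ≡⟨ +-comm _ (M % p ^ n) ⟩
  M % p ^ n + M / p ^ n * p ^ n
    ≡⟨ sym (m≡m%n+[m/n]*n M (p ^ n)) ⟩
  M ∎
  where
  open ≡-Reasoning
  instance _ = m^n≢0 p n

reps-over : ∀ p .{{_ : NonZero p}} → ℕ → List (DRep p)
reps-over p j = map (λ M → j , toDigits p j M) (upTo (p ^ j))

∣⇒≈D-reps-over : ∀ p .{{_ : NonZero p}} j {n} (ds : Vec (Fin p) n) →
  p ^ n ∣ numer ds * p ^ j → Any ((n , ds) ≈D_) (reps-over p j)
∣⇒≈D-reps-over p j {n} ds (divides M Np^j≡Mp^n) =
  map⁺ (lose (∈-upTo⁺ M<p^j) (trans Np^j≡Mp^n (cong (_* p ^ n) (sym (numer-toDigits p j M<p^j)))))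
  where
  M<p^j : M < p ^ j
  M<p^j = *-cancelʳ-< (p ^ n) M (p ^ j) (subst (_< p ^ j * p ^ n) Np^j≡Mp^n
            (subst (numer ds * p ^ j <_) (*-comm (p ^ n) (p ^ j)) (*-monoˡ-< (p ^ j) {{m^n≢0 p j}} (numer<p^n ds))))

corollary1p3 : (q : ℕ) → (hq : 3 ≤ q) → (p : ℕ) → (hp : 2 ≤ p) → gcd p q ≡ 1 →
    Σ (List (DRep p)) (λ E →
      (x : DRep p) → ¬ Any (λ e → x ≈D e) E →
        (c : ℕ) → c < q → Σ ℕ (λ k → (1 ≤ k) × (qDigit p q hp hq x k ≡ c)))
corollary1p3 q hq p hp gcd[p,q]≡1 = reps-over p (a + a) , every-digit
  where
  instance
    p≢0 : NonZero p
    p≢0 = >-nonZero (≤-trans (s≤s z≤n) hp)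
    q≢0 : NonZero q
    q≢0 = >-nonZero (≤-trans (s≤s z≤n) hq)
    p*p≢0 : NonZero (p * p)
    p*p≢0 = m*n≢0 p p
  p*p⊥q : Coprime (p * p) q
  p*p⊥q = subst (λ t → Coprime (p * t) q) (*-identityʳ p)
            (Coprime.sym (coprime-^ʳ {q} {p} 2 (Coprime.sym (gcd≡1⇒coprime gcd[p,q]≡1))))
  order : ∃[ e ] ∃[ h ] 1 ≤ h × q ^ e ≡ 1 + h × p * p ∣ h
  order = power≡1+multiple (p * p) q (≤-trans (n≤1+n 2) hq) p*p⊥q
  e = proj₁ order
  h₀ = proj₁ (proj₂ order)
  instance
    h₀≢0 : NonZero h₀
    h₀≢0 = >-nonZero (proj₁ (proj₂ (proj₂ order)))
  q^e≡1+h₀ : q ^ e ≡ 1 + h₀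
  q^e≡1+h₀ = proj₁ (proj₂ (proj₂ (proj₂ order)))
  p²∣h₀ : p * p ∣ h₀
  p²∣h₀ = proj₂ (proj₂ (proj₂ (proj₂ order)))
  a = suc (q + h₀)
  every-digit : (x : DRep p) → ¬ Any (x ≈D_) (reps-over p (a + a)) →
    (c : ℕ) → c < q → ∃[ k ] 1 ≤ k × qDigit p q hp hq x k ≡ c
  every-digit (n , ds) x∉E c c<q =
    let K , digit≡c = every-digit-occurs {e = e} q^e≡1+h₀ p²∣h₀ n (numer ds) a ≤-refl
                        (λ p^n∣ → x∉E (∣⇒≈D-reps-over p (a + a) ds p^n∣)) c<q
    in suc K , s≤s z≤n , digit≡c
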